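{- Let $m\ge n$ be positive integers, and let $G$ be a $(1,2)$-step competition graph of an orientation of $K_{m,n}$ having the minimum possible number of edges among all orientations of $K_{m,n}$. Then $|E(G)|=0$ if $m=n=2$, and $|E(G)|=\binom{n}{2}$ otherwise.
   Context: For vertices $x,y$ of a digraph $H$, $d_H(x,y)$ is the length of a shortest directed $(x,y)$-path. The $(1,2)$-step competition graph $C_{1,2}(D)$ of a digraph $D$ is the simple graph on $V(D)$ in which distinct $u,v$ are adjacent iff there is $w\neq u,v$ with either $d_{D-v}(u,w)\le 1$ and $d_{D-u}(v,w)\le 2$, or $d_{D-u}(v,w)\le 1$ and $d_{D-v}(u,w)\le 2$. -}

module Defs where

open import Data.Nat using (ℕ; _+_)
open import Data.Bool using (Bool; true; false; not; T; T?)
open import Data.Fin using (Fin; splitAt; _<_; _<?_)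
open import Data.Fin.Properties using (any?; _≟_)
open import Data.Sum using (_⊎_; inj₁; inj₂)
open import Data.Product using (_×_; _,_; ∃; ∃-syntax)
open import Data.List using (List; length; filter; allFin; cartesianProduct)
open import Relation.Nullary using (¬_; Dec)
open import Relation.Nullary.Decidable using (_×-dec_; _⊎-dec_; ¬?)
open import Relation.Binary.PropositionalEquality using (_≡_)

Digraph : ℕ → Set
Digraph N = Fin N → Fin N → Bool

Arc : ∀ {N} → Digraph N → Fin N → Fin N → Set
Arc D u v = T (D u v)

-- d_{D - z}(x , w) ≤ 1, for x , w ≠ z and x ≠ w : an arc x → w.
Dist≤1 : ∀ {N} → Digraph N → (z x w : Fin N) → Set
Dist≤1 D z x w = Arc D x w

-- d_{D - z}(x , w) ≤ 2, for x , w ≠ z and x ≠ w :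
-- an arc x → w, or a path x → y → w with y a vertex of D - z.
Dist≤2 : ∀ {N} → Digraph N → (z x w : Fin N) → Set
Dist≤2 D z x w = Arc D x w ⊎ ∃[ y ] (¬ (y ≡ z) × Arc D x y × Arc D y w)

Adj₁₂ : ∀ {N} → Digraph N → Fin N → Fin N → Set
Adj₁₂ D u v =
  ¬ (u ≡ v) ×
  ∃[ w ] (¬ (w ≡ u) × ¬ (w ≡ v) ×
          ((Dist≤1 D v u w × Dist≤2 D u v w) ⊎ (Dist≤1 D u v w × Dist≤2 D v u w)))

Adj₁₂? : ∀ {N} (D : Digraph N) (u v : Fin N) → Dec (Adj₁₂ D u v)
Adj₁₂? D u v =
  ¬? (u ≟ v) ×-dec
  any? (λ w → ¬? (w ≟ u) ×-dec ¬? (w ≟ v) ×-dec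
          ((T? (D u w) ×-dec d2 u v w) ⊎-dec (T? (D v w) ×-dec d2 v u w)))
  where
  d2 : ∀ z x w → Dec (Dist≤2 D z x w)
  d2 z x w = T? (D x w) ⊎-dec any? (λ y → ¬? (y ≟ z) ×-dec T? (D x y) ×-dec T? (D y w))

edges₁₂ : ∀ {N} → Digraph N → ℕ
edges₁₂ {N} D =
  length (filter (λ { (u , v) → (u <? v) ×-dec Adj₁₂? D u v })
                 (cartesianProduct (allFin N) (allFin N)))

-- An orientation of K_{m,n} with parts A = Fin m and B = Fin n:
-- O i j = true means a_i → b_j, false means b_j → a_i.
Orientation : ℕ → ℕ → Set
Orientation m n = Fin m → Fin n → Bool

toDigraph : ∀ {m n} → Orientation m n → Digraph (m + n)
toDigraph {m} {n} O x y with splitAt m x | splitAt m y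
... | inj₁ i | inj₂ j = O i j
... | inj₂ j | inj₁ i = not (O i j)
... | _      | _      = false

-- Orienting every edge of K_{m,n} from B into A leaves no directed 2-path, so only pairs
-- inside B, which share every out-neighbour a_i, are adjacent in C₁₂: at most C(n,2) edges;
-- for K_{2,2} the directed 4-cycle gives none. Conversely, for m ≥ 3 every orientation has at
-- least C(n,2) edges: each pair j < k is sent injectively to an edge of C₁₂, by cases on whether
-- some a_i is a sink, some a_{i₀} has a unique out-neighbour b_{j₀}, or every a_i has two
-- out-neighbours; in the last case n ≤ m lets a_j stand in for b_j.

module Submission where

open import Defs
open import Data.Nat using (ℕ; _≤_; _<_; _+_)
open import Data.Nat.Combinatorics using (_C_)
open import Data.Product using (_×_)
open import Relation.Nullary using (¬_)
open import Relation.Binary.PropositionalEquality using (_≡_)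

open import Data.Nat using (zero; suc; z≤n; s≤s)
import Data.Nat.Properties as ℕ
open import Data.Nat.Combinatorics using (nC1≡n; nCk+nC[k+1]≡[n+1]C[k+1])
open import Data.Bool as Bool using (true; false)
open import Data.Bool.Properties using (¬-not; not-¬)
open import Data.Unit using (tt)
open import Data.Empty using (⊥-elim)
open import Function using (_∘_)
open import Data.Fin as Fin using (Fin; zero; suc; toℕ; _↑ˡ_; _↑ʳ_; splitAt; inject≤; _<?_)
open import Data.Fin.Properties
  using ( _≟_; any?; all?; ¬∀⟶∃¬; <⇒≢; <-asym; injective⇒≤; suc-injective; toℕ-injective
        ; toℕ<n; toℕ-↑ˡ; toℕ-↑ʳ; ↑ˡ-injective; ↑ʳ-injective; toℕ-inject≤
        ; splitAt-↑ˡ; splitAt-↑ʳ; splitAt⁻¹-↑ˡ; splitAt⁻¹-↑ʳ)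
open import Data.Product as Product using (∃; ∃-syntax; _,_; proj₁; proj₂)
open import Data.Product.Properties using (,-injectiveˡ; ,-injectiveʳ)
open import Data.Sum as Sum using (_⊎_; inj₁; inj₂)
open import Data.List
  using (List; []; _∷_; length; lookup; map; _++_; filter; allFin; cartesianProduct)
open import Data.List.Properties using (length-map; length-++; length-tabulate)
open import Data.List.Relation.Unary.All as All using ()
open import Data.List.Relation.Unary.AllPairs using ([]; _∷_)
open import Data.List.Relation.Unary.Unique.Propositional using (Unique)
import Data.List.Relation.Unary.Unique.Propositional.Properties as Unique
open import Data.List.Membership.Propositional using (_∈_)
open import Data.List.Membership.Propositional.Properties
  using ( ∈-lookup; ∈-map⁺; ∈-map⁻; ∈-++⁺ˡ; ∈-++⁺ʳ; ∈-++⁻; ∈-allFin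
        ; ∈-filter⁺; ∈-filter⁻; ∈-cartesianProduct⁺)
open import Data.List.Membership.Setoid.Properties using (index-injective)
open import Relation.Nullary using (yes; no; does; contradiction)
open import Relation.Nullary.Decidable using (_×-dec_; ¬?)
open import Relation.Unary using (Decidable)
open import Relation.Binary.PropositionalEquality
  using (_≢_; refl; sym; trans; cong; cong₂; subst; setoid; module ≡-Reasoning)

private
  variable
    A B : Set
    m n N : ℕ

∃-or-∀¬ : {P : Fin n → Set} → Decidable P → ∃ P ⊎ (∀ x → ¬ P x)
∃-or-∀¬ P? with any? P?
... | yes ∃P = inj₁ ∃P
... | no ¬∃P = inj₂ λ x Px → ¬∃P (x , Px)

two-others : 3 ≤ m → (i₀ : Fin m) → ∃[ i₁ ] ∃[ i₂ ] i₁ ≢ i₀ × i₂ ≢ i₀ × i₁ Fin.< i₂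
two-others (s≤s (s≤s (s≤s _))) zero = suc zero , suc (suc zero) , (λ ()) , (λ ()) , s≤s (s≤s z≤n)
two-others (s≤s (s≤s (s≤s _))) (suc zero) = zero , suc (suc zero) , (λ ()) , (λ ()) , s≤s z≤n
two-others (s≤s (s≤s (s≤s _))) (suc (suc _)) = zero , suc zero , (λ ()) , (λ ()) , s≤s z≤n

Unique⇒lookup-injective : {xs : List A} → Unique xs →
                          ∀ {i j} → lookup xs i ≡ lookup xs j → i ≡ j
Unique⇒lookup-injective (_ ∷ _) {zero} {zero} _ = refl
Unique⇒lookup-injective (x∉xs ∷ _) {zero} {suc j} x≡xⱼ =
  contradiction x≡xⱼ (All.lookup x∉xs (∈-lookup j))
Unique⇒lookup-injective (x∉xs ∷ _) {suc i} {zero} xᵢ≡x =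
  contradiction (sym xᵢ≡x) (All.lookup x∉xs (∈-lookup i))
Unique⇒lookup-injective (_ ∷ xs!) {suc i} {suc j} xᵢ≡xⱼ =
  cong suc (Unique⇒lookup-injective xs! xᵢ≡xⱼ)

injection⇒length-≤ : {xs : List A} {ys : List B} → Unique xs →
  (f : ∀ {x} → x ∈ xs → B) → (∀ {x} (x∈xs : x ∈ xs) → f x∈xs ∈ ys) →
  (∀ {x y} (x∈xs : x ∈ xs) (y∈xs : y ∈ xs) → f x∈xs ≡ f y∈xs → x ≡ y) →
  length xs ≤ length ys
injection⇒length-≤ {B = B} xs! f f∈ys f-injective =
  injective⇒≤ λ {i} {j} eq →
    Unique⇒lookup-injective xs!
      (f-injective (∈-lookup i) (∈-lookup j)
        (index-injective (setoid B) (f∈ys (∈-lookup i)) (f∈ys (∈-lookup j)) eq))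

pairs-with-zero : (n : ℕ) → List (Fin (suc n) × Fin (suc n))
pairs-with-zero n = map (λ k → zero , suc k) (allFin n)

pairs : (n : ℕ) → List (Fin n × Fin n)
pairs zero = []
pairs (suc n) = pairs-with-zero n ++ map (Product.map suc suc) (pairs n)

length-pairs : ∀ n → length (pairs n) ≡ n C 2
length-pairs zero = refl
length-pairs (suc n) = begin
  length (pairs-with-zero n ++ map (Product.map suc suc) (pairs n))
    ≡⟨ length-++ (pairs-with-zero n) ⟩
  length (pairs-with-zero n) + length (map (Product.map suc suc) (pairs n))
    ≡⟨ cong₂ _+_ (trans (length-map _ (allFin n)) (length-tabulate _))
                 (trans (length-map _ (pairs n)) (length-pairs n)) ⟩
  n + n C 2
    ≡⟨ cong (_+ n C 2) (sym (nC1≡n n)) ⟩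
  n C 1 + n C 2
    ≡⟨ nCk+nC[k+1]≡[n+1]C[k+1] n 1 ⟩
  suc n C 2 ∎
  where open ≡-Reasoning

∈-pairs⁻ : ∀ n {j k} → (j , k) ∈ pairs n → j Fin.< k
∈-pairs⁻ (suc n) p with ∈-++⁻ (pairs-with-zero n) p
... | inj₁ q with _ , _ , refl ← ∈-map⁻ _ q = s≤s z≤n
... | inj₂ q with _ , r , refl ← ∈-map⁻ _ q = s≤s (∈-pairs⁻ n r)

∈-pairs⁺ : ∀ n {j k : Fin n} → j Fin.< k → (j , k) ∈ pairs n
∈-pairs⁺ (suc n) {zero} {suc k} _ = ∈-++⁺ˡ (∈-map⁺ _ (∈-allFin k))
∈-pairs⁺ (suc n) {suc j} {suc k} (s≤s j<k) =
  ∈-++⁺ʳ (pairs-with-zero n) (∈-map⁺ (Product.map suc suc) (∈-pairs⁺ n j<k))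

pairs-unique : ∀ n → Unique (pairs n)
pairs-unique zero = []
pairs-unique (suc n) = Unique.++⁺
  (Unique.map⁺ (λ eq → suc-injective (,-injectiveʳ eq)) (Unique.allFin⁺ n))
  (Unique.map⁺ (λ eq → cong₂ _,_ (suc-injective (,-injectiveˡ eq)) (suc-injective (,-injectiveʳ eq)))
    (pairs-unique n))
  disjoint
  where
  disjoint : ∀ {jk} → ¬ (jk ∈ pairs-with-zero n × jk ∈ map (Product.map suc suc) (pairs n))
  disjoint (p , q) with _ , _ , refl ← ∈-map⁻ _ p | _ , _ , () ← ∈-map⁻ _ q

module _ (D : Digraph N) where

  Adj₁₂-sym : ∀ {u v} → Adj₁₂ D u v → Adj₁₂ D v u
  Adj₁₂-sym (u≢v , w , w≢u , w≢v , reach) =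
    (λ v≡u → u≢v (sym v≡u)) , w , w≢v , w≢u , Sum.swap reach

  Adj₁₂-common-out : ∀ {u v w} → u ≢ v → w ≢ u → w ≢ v →
                     Arc D u w → Arc D v w → Adj₁₂ D u v
  Adj₁₂-common-out u≢v w≢u w≢v u→w v→w = u≢v , _ , w≢u , w≢v , inj₁ (u→w , inj₁ v→w)

  Adj₁₂-out-path : ∀ {u v w y} → u ≢ v → w ≢ u → w ≢ v → y ≢ u →
                   Arc D u w → Arc D v y → Arc D y w → Adj₁₂ D u v
  Adj₁₂-out-path u≢v w≢u w≢v y≢u u→w v→y y→w =
    u≢v , _ , w≢u , w≢v , inj₁ (u→w , inj₂ (_ , y≢u , v→y , y→w))

  Adj₁₂⇒common-out : (∀ {x y z} → Arc D x y → ¬ Arc D y z) →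
                     ∀ {u v} → Adj₁₂ D u v → ∃[ w ] Arc D u w × Arc D v w
  Adj₁₂⇒common-out _ (_ , w , _ , _ , inj₁ (u→w , inj₁ v→w)) = w , u→w , v→w
  Adj₁₂⇒common-out _ (_ , w , _ , _ , inj₂ (v→w , inj₁ u→w)) = w , u→w , v→w
  Adj₁₂⇒common-out no-path (_ , _ , _ , _ , inj₁ (_ , inj₂ (_ , _ , v→y , y→w))) =
    contradiction y→w (no-path v→y)
  Adj₁₂⇒common-out no-path (_ , _ , _ , _ , inj₂ (_ , inj₂ (_ , _ , u→y , y→w))) =
    contradiction y→w (no-path u→y)

  Edge : Fin N × Fin N → Set
  Edge (u , v) = u Fin.< v × Adj₁₂ D u v

  edge? : Decidable Edge
  edge? (u , v) = (u <? v) ×-dec Adj₁₂? D u v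

  edgeList : List (Fin N × Fin N)
  edgeList = filter edge? (cartesianProduct (allFin N) (allFin N))

  ∈-edgeList⁺ : ∀ {e} → Edge e → e ∈ edgeList
  ∈-edgeList⁺ = ∈-filter⁺ edge? (∈-cartesianProduct⁺ (∈-allFin _) (∈-allFin _))

  ∈-edgeList⁻ : ∀ {e} → e ∈ edgeList → Edge e
  ∈-edgeList⁻ e∈ = proj₂ (∈-filter⁻ edge? {xs = cartesianProduct (allFin N) (allFin N)} e∈)

  edgeList-unique : Unique edgeList
  edgeList-unique =
    Unique.filter⁺ edge? (Unique.cartesianProduct⁺ (Unique.allFin⁺ N) (Unique.allFin⁺ N))

  C₂≤edges₁₂ : (Witness : Fin n → Fin n → Fin N × Fin N → Set) →
    (∀ {j k} → j Fin.< k → ∃[ e ] Edge e × Witness j k e) →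
    (∀ {j k j′ k′ e e′} → j Fin.< k → j′ Fin.< k′ →
       Witness j k e → Witness j′ k′ e′ → e ≡ e′ → (j , k) ≡ (j′ , k′)) →
    n C 2 ≤ edges₁₂ D
  C₂≤edges₁₂ {n} Witness witness unambiguous =
    subst (_≤ edges₁₂ D) (length-pairs n)
      (injection⇒length-≤ (pairs-unique n)
        (λ jk∈ → proj₁ (witness-of jk∈))
        (λ jk∈ → ∈-edgeList⁺ (proj₁ (proj₂ (witness-of jk∈))))
        (λ jk∈ jk∈′ → unambiguous (∈-pairs⁻ n jk∈) (∈-pairs⁻ n jk∈′)
                        (proj₂ (proj₂ (witness-of jk∈))) (proj₂ (proj₂ (witness-of jk∈′)))))
    where
    witness-of : ∀ {j k} → (j , k) ∈ pairs n → ∃[ e ] Edge e × Witness j k e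
    witness-of jk∈ = witness (∈-pairs⁻ n jk∈)

module _ {m n : ℕ} where

  a : Fin m → Fin (m + n)
  a i = i ↑ˡ n

  b : Fin n → Fin (m + n)
  b j = m ↑ʳ j

  a<b : ∀ (i : Fin m) (j : Fin n) → a i Fin.< b j
  a<b i j rewrite toℕ-↑ˡ i n | toℕ-↑ʳ m j = ℕ.<-≤-trans (toℕ<n i) (ℕ.m≤m+n m (toℕ j))

  a≢b : ∀ {i : Fin m} {j : Fin n} → a i ≢ b j
  a≢b {i = i} {j} ai≡bj = ℕ.<-irrefl (cong toℕ ai≡bj) (a<b i j)

  a-mono : ∀ {i i′ : Fin m} → i Fin.< i′ → a i Fin.< a i′
  a-mono {i} {i′} i<i′ rewrite toℕ-↑ˡ i n | toℕ-↑ˡ i′ n = i<i′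

  b-mono : ∀ {j j′ : Fin n} → j Fin.< j′ → b j Fin.< b j′
  b-mono {j} {j′} j<j′ rewrite toℕ-↑ʳ m j | toℕ-↑ʳ m j′ = ℕ.+-monoʳ-< m j<j′

  b-mono⁻ : ∀ {j j′ : Fin n} → b j Fin.< b j′ → j Fin.< j′
  b-mono⁻ {j} {j′} bj<bj′ rewrite toℕ-↑ʳ m j | toℕ-↑ʳ m j′ = ℕ.+-cancelˡ-< m _ _ bj<bj′

  a-injective : ∀ {i i′ : Fin m} → a i ≡ a i′ → i ≡ i′
  a-injective = ↑ˡ-injective n _ _

  b-injective : ∀ {j j′ : Fin n} → b j ≡ b j′ → j ≡ j′
  b-injective = ↑ʳ-injective m _ _

  module _ (O : Orientation m n) where

    private
      D = toDigraph O

    arc-ab : ∀ {i j} → O i j ≡ true → Arc D (a i) (b j)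
    arc-ab {i} {j} Oij≡true rewrite splitAt-↑ˡ m i n | splitAt-↑ʳ m n j | Oij≡true = tt

    arc-ba : ∀ {i j} → O i j ≡ false → Arc D (b j) (a i)
    arc-ba {i} {j} Oij≡false rewrite splitAt-↑ˡ m i n | splitAt-↑ʳ m n j | Oij≡false = tt

    AnotherOutA : Fin m → Fin n → Set
    AnotherOutA i j = ∃[ j′ ] j′ ≢ j × O i j′ ≡ true

    AnotherOutB : Fin n → Fin m → Set
    AnotherOutB j i = ∃[ i′ ] i′ ≢ i × O i′ j ≡ false

    SoleOutA : Fin m → Fin n → Set
    SoleOutA i j = O i j ≡ true × (∀ j′ → j′ ≢ j → O i j′ ≡ false)

    SoleOutB : Fin n → Fin m → Set
    SoleOutB j i = O i j ≡ false × (∀ i′ → i′ ≢ i → O i′ j ≡ true)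

    IsSinkA : Fin m → Set
    IsSinkA i = ∀ j → O i j ≡ false

    TwoOutsA : Fin m → Set
    TwoOutsA i = ∃[ j ] ∃[ j′ ] j ≢ j′ × O i j ≡ true × O i j′ ≡ true

    edge-aa : ∀ {i i′ j} → i Fin.< i′ → O i j ≡ true → O i′ j ≡ true → Edge D (a i , a i′)
    edge-aa i<i′ Oij Oi′j =
      a-mono i<i′ ,
      Adj₁₂-common-out D (<⇒≢ (a-mono i<i′)) (a≢b ∘ sym) (a≢b ∘ sym) (arc-ab Oij) (arc-ab Oi′j)

    edge-bb : ∀ {j j′ i} → j Fin.< j′ → O i j ≡ false → O i j′ ≡ false → Edge D (b j , b j′)
    edge-bb j<j′ Oij Oij′ =
      b-mono j<j′ , Adj₁₂-common-out D (<⇒≢ (b-mono j<j′)) a≢b a≢b (arc-ba Oij) (arc-ba Oij′)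

    -- a_i → b_j′ and b_j → a_i′: whichever way the arc between a_i′ and b_j′ points,
    -- it extends one of these arcs to a 2-path.
    edge-ab : ∀ {i j} → AnotherOutA i j → AnotherOutB j i → Edge D (a i , b j)
    edge-ab {i} {j} (j′ , j′≢j , Oij′) (i′ , i′≢i , Oi′j) with O i′ j′ in Oi′j′
    ... | true  = a<b i j ,
      Adj₁₂-out-path D a≢b (a≢b ∘ sym) (j′≢j ∘ b-injective) (i′≢i ∘ a-injective)
        (arc-ab Oij′) (arc-ba Oi′j) (arc-ab Oi′j′)
    ... | false = a<b i j , Adj₁₂-sym D
      (Adj₁₂-out-path D (a≢b ∘ sym) a≢b (i′≢i ∘ a-injective) (j′≢j ∘ b-injective)
        (arc-ba Oi′j) (arc-ab Oij′) (arc-ba Oi′j′))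

    SoleOutA-unique : ∀ {i j j′} → SoleOutA i j → SoleOutA i j′ → j ≡ j′
    SoleOutA-unique {j = j} {j′} (Oij , _) (_ , others) with j ≟ j′
    ... | yes j≡j′ = j≡j′
    ... | no j≢j′ = contradiction (others j j≢j′) (not-¬ Oij)

    SoleOutB-unique : ∀ {j i i′} → SoleOutB j i → SoleOutB j i′ → i ≡ i′
    SoleOutB-unique {i = i} {i′} (Oij , _) (_ , others) with i ≟ i′
    ... | yes i≡i′ = i≡i′
    ... | no i≢i′ = contradiction (others i i≢i′) (not-¬ Oij)

    anotherOutA-or-none : ∀ i j → AnotherOutA i j ⊎ (∀ j′ → j′ ≢ j → O i j′ ≡ false)
    anotherOutA-or-none i j = Sum.map₂ (λ none j′ j′≢j → ¬-not (λ Oij′ → none j′ (j′≢j , Oij′)))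
      (∃-or-∀¬ λ j′ → ¬? (j′ ≟ j) ×-dec (O i j′ Bool.≟ true))

    anotherOutB-or-none : ∀ j i → AnotherOutB j i ⊎ (∀ i′ → i′ ≢ i → O i′ j ≡ true)
    anotherOutB-or-none j i = Sum.map₂ (λ none i′ i′≢i → ¬-not (λ Oi′j → none i′ (i′≢i , Oi′j)))
      (∃-or-∀¬ λ i′ → ¬? (i′ ≟ i) ×-dec (O i′ j Bool.≟ false))

    twoOutsA? : Decidable TwoOutsA
    twoOutsA? i =
      any? λ j → any? λ j′ → ¬? (j ≟ j′) ×-dec (O i j Bool.≟ true) ×-dec (O i j′ Bool.≟ true)

    TwoOutsA⇒AnotherOutA : ∀ {i} → TwoOutsA i → ∀ j → AnotherOutA i j
    TwoOutsA⇒AnotherOutA (j₁ , j₂ , j₁≢j₂ , Oij₁ , Oij₂) j with j₁ ≟ j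
    ... | yes refl = j₂ , j₁≢j₂ ∘ sym , Oij₂
    ... | no j₁≢j = j₁ , j₁≢j , Oij₁

    sink-or-sole : ∀ {i} → ¬ TwoOutsA i → IsSinkA i ⊎ ∃ (SoleOutA i)
    sink-or-sole {i} ¬two with ∃-or-∀¬ (λ j → O i j Bool.≟ true)
    ... | inj₂ none = inj₁ λ j → ¬-not (none j)
    ... | inj₁ (j , Oij) with anotherOutA-or-none i j
    ...   | inj₁ (j′ , j′≢j , Oij′) = contradiction (j , j′ , j′≢j ∘ sym , Oij , Oij′) ¬two
    ...   | inj₂ none = inj₂ (j , Oij , none)

-- The upper bound

  into-A : Orientation m n
  into-A _ _ = false

  arc-into-A : ∀ {x y} → Arc (toDigraph into-A) x y → (∃[ j ] x ≡ b j) × (∃[ i ] y ≡ a i)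
  arc-into-A {x} {y} x→y with splitAt m x in split-x | splitAt m y in split-y
  ... | inj₂ j | inj₁ i = (j , sym (splitAt⁻¹-↑ʳ split-x)) , (i , sym (splitAt⁻¹-↑ˡ split-y))
  ... | inj₁ _ | inj₁ _ = ⊥-elim x→y
  ... | inj₁ _ | inj₂ _ = ⊥-elim x→y
  ... | inj₂ _ | inj₂ _ = ⊥-elim x→y

  edges₁₂-into-A : edges₁₂ (toDigraph into-A) ≤ n C 2
  edges₁₂-into-A =
    subst (edges₁₂ D ≤_) (trans (length-map _ (pairs n)) (length-pairs n))
      (injection⇒length-≤ (edgeList-unique D) (λ {e} _ → e) B-pair (λ _ _ e≡e′ → e≡e′))
    where
    D = toDigraph into-A

    no-2-path : ∀ {x y z} → Arc D x y → ¬ Arc D y z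
    no-2-path x→y y→z with (_ , (_ , refl)) ← arc-into-A x→y | ((_ , ai≡bj) , _) ← arc-into-A y→z =
      a≢b ai≡bj

    B-pair : ∀ {e} → e ∈ edgeList D → e ∈ map (Product.map b b) (pairs n)
    B-pair {u , v} uv∈
      with (u<v , u~v) ← ∈-edgeList⁻ D uv∈
      with (_ , u→w , v→w) ← Adj₁₂⇒common-out D no-2-path u~v
      with ((_ , refl) , _) ← arc-into-A u→w | ((_ , refl) , _) ← arc-into-A v→w =
      ∈-map⁺ _ (∈-pairs⁺ n (b-mono⁻ u<v))

-- The lower bound

  module _ (O : Orientation m n) where

    private
      D = toDigraph O

    C₂≤edges₁₂-sink : ∀ {i} → IsSinkA O i → n C 2 ≤ edges₁₂ D
    C₂≤edges₁₂-sink sink =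
      C₂≤edges₁₂ D (λ j k e → e ≡ (b j , b k))
        (λ j<k → _ , edge-bb O j<k (sink _) (sink _) , refl)
        λ where _ _ refl refl bb≡bb′ → cong₂ _,_ (b-injective (,-injectiveˡ bb≡bb′))
                                                (b-injective (,-injectiveʳ bb≡bb′))

    -- A pair {j₀, c} is witnessed by an edge at b_c or, failing that, by a_{i₁} a_{i₂}; then
    -- b_c is the sole out-neighbour of a_{i₁}, which recovers c.
    module SoleOut {i₀ j₀} (sole : SoleOutA O i₀ j₀)
                   {i₁ i₂} (i₁≢i₀ : i₁ ≢ i₀) (i₂≢i₀ : i₂ ≢ i₀) (i₁<i₂ : i₁ Fin.< i₂) where

      i₀→only-j₀ : ∀ j → j ≢ j₀ → O i₀ j ≡ false
      i₀→only-j₀ = proj₂ sole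

      PairOf : Fin n → Fin n → Fin n → Set
      PairOf j k c = (j ≡ j₀ × k ≡ c) ⊎ (k ≡ j₀ × j ≡ c)

      data Witness (j k : Fin n) : Fin (m + n) × Fin (m + n) → Set where
        avoiding-j₀ : Witness j k (b j , b k)
        via-b : ∀ {i} c → PairOf j k c → Witness j k (a i , b c)
        via-a : ∀ c → PairOf j k c → SoleOutA O i₁ c → Witness j k (a i₁ , a i₂)

      witness-with-j₀ : ∀ {j k} c → c ≢ j₀ → PairOf j k c → ∃[ e ] Edge D e × Witness j k e
      witness-with-j₀ c c≢j₀ jk=j₀c with anotherOutB-or-none O c i₀
      ... | inj₁ c→elsewhere =
        _ , edge-ab O (j₀ , c≢j₀ ∘ sym , proj₁ sole) c→elsewhere , via-b c jk=j₀c
      ... | inj₂ c→only-i₀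
        with anotherOutA-or-none O i₁ c | anotherOutA-or-none O i₂ c
      ... | inj₁ i₁→elsewhere | _ =
        _ , edge-ab O i₁→elsewhere (i₀ , i₁≢i₀ ∘ sym , i₀→only-j₀ c c≢j₀) , via-b c jk=j₀c
      ... | inj₂ _ | inj₁ i₂→elsewhere =
        _ , edge-ab O i₂→elsewhere (i₀ , i₂≢i₀ ∘ sym , i₀→only-j₀ c c≢j₀) , via-b c jk=j₀c
      ... | inj₂ i₁→only-c | inj₂ _ =
        _ , edge-aa O i₁<i₂ (c→only-i₀ i₁ i₁≢i₀) (c→only-i₀ i₂ i₂≢i₀) ,
        via-a c jk=j₀c (c→only-i₀ i₁ i₁≢i₀ , i₁→only-c)

      witness : ∀ {j k} → j Fin.< k → ∃[ e ] Edge D e × Witness j k e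
      witness {j} {k} j<k with j ≟ j₀ | k ≟ j₀
      ... | yes j≡j₀ | _ =
        witness-with-j₀ k (λ k≡j₀ → <⇒≢ j<k (trans j≡j₀ (sym k≡j₀))) (inj₁ (j≡j₀ , refl))
      ... | no j≢j₀ | yes k≡j₀ = witness-with-j₀ j j≢j₀ (inj₂ (k≡j₀ , refl))
      ... | no j≢j₀ | no k≢j₀ =
        _ , edge-bb O j<k (i₀→only-j₀ j j≢j₀) (i₀→only-j₀ k k≢j₀) , avoiding-j₀

      PairOf-unambiguous : ∀ {j k j′ k′ c} → j Fin.< k → j′ Fin.< k′ →
                           PairOf j k c → PairOf j′ k′ c → (j , k) ≡ (j′ , k′)
      PairOf-unambiguous _ _ (inj₁ (refl , refl)) (inj₁ (refl , refl)) = refl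
      PairOf-unambiguous _ _ (inj₂ (refl , refl)) (inj₂ (refl , refl)) = refl
      PairOf-unambiguous j<k j′<k′ (inj₁ (refl , refl)) (inj₂ (refl , refl)) =
        contradiction j′<k′ (<-asym j<k)
      PairOf-unambiguous j<k j′<k′ (inj₂ (refl , refl)) (inj₁ (refl , refl)) =
        contradiction j′<k′ (<-asym j<k)

      unambiguous : ∀ {j k j′ k′ e e′} → j Fin.< k → j′ Fin.< k′ →
                    Witness j k e → Witness j′ k′ e′ → e ≡ e′ → (j , k) ≡ (j′ , k′)
      unambiguous _ _ avoiding-j₀ avoiding-j₀ e≡e′ =
        cong₂ _,_ (b-injective (,-injectiveˡ e≡e′)) (b-injective (,-injectiveʳ e≡e′))
      unambiguous j<k j′<k′ (via-b c jk=j₀c) (via-b c′ j′k′=j₀c′) e≡e′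
        with refl ← b-injective (,-injectiveʳ e≡e′) = PairOf-unambiguous j<k j′<k′ jk=j₀c j′k′=j₀c′
      unambiguous j<k j′<k′ (via-a c jk=j₀c i₁→c) (via-a c′ j′k′=j₀c′ i₁→c′) _
        with refl ← SoleOutA-unique O i₁→c i₁→c′ = PairOf-unambiguous j<k j′<k′ jk=j₀c j′k′=j₀c′
      unambiguous _ _ avoiding-j₀ (via-b _ _) e≡e′ = contradiction (sym (,-injectiveˡ e≡e′)) a≢b
      unambiguous _ _ avoiding-j₀ (via-a _ _ _) e≡e′ = contradiction (sym (,-injectiveˡ e≡e′)) a≢b
      unambiguous _ _ (via-b _ _) avoiding-j₀ e≡e′ = contradiction (,-injectiveˡ e≡e′) a≢b
      unambiguous _ _ (via-a _ _ _) avoiding-j₀ e≡e′ = contradiction (,-injectiveˡ e≡e′) a≢b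
      unambiguous _ _ (via-b _ _) (via-a _ _ _) e≡e′ = contradiction (sym (,-injectiveʳ e≡e′)) a≢b
      unambiguous _ _ (via-a _ _ _) (via-b _ _) e≡e′ = contradiction (,-injectiveʳ e≡e′) a≢b

      C₂≤edges₁₂-sole-out : n C 2 ≤ edges₁₂ D
      C₂≤edges₁₂-sole-out = C₂≤edges₁₂ D Witness witness unambiguous

    module TwoOuts (n≤m : n ≤ m) (two : ∀ i → TwoOutsA O i) where

      ι : Fin n → Fin m
      ι j = inject≤ j n≤m

      ι-mono : ∀ {j k} → j Fin.< k → ι j Fin.< ι k
      ι-mono {j} {k} j<k rewrite toℕ-inject≤ j n≤m | toℕ-inject≤ k n≤m = j<k

      ι-injective : ∀ {j k} → ι j ≡ ι k → j ≡ k
      ι-injective {j} {k} ιj≡ιk =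
        toℕ-injective (trans (sym (toℕ-inject≤ j n≤m)) (trans (cong toℕ ιj≡ιk) (toℕ-inject≤ k n≤m)))

      another-out : ∀ i j → AnotherOutA O i j
      another-out i = TwoOutsA⇒AnotherOutA O (two i)

      data Witness (j k : Fin n) : Fin (m + n) × Fin (m + n) → Set where
        shared : Witness j k (a (ι j) , b k)
        sole   : SoleOutB O k (ι j) → Witness j k (a (ι k) , b k)
        common : Witness j k (a (ι j) , a (ι k))

      witness : ∀ {j k} → j Fin.< k → ∃[ e ] Edge D e × Witness j k e
      witness {j} {k} j<k with anotherOutB-or-none O k (ι j)
      ... | inj₁ k→elsewhere = _ , edge-ab O (another-out (ι j) k) k→elsewhere , shared
      ... | inj₂ k→only-ιj with O (ι j) k in Oιjk
      ...   | false =
        _ , edge-ab O (another-out (ι k) k) (ι j , ιj≢ιk , Oιjk) , sole (Oιjk , k→only-ιj)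
        where ιj≢ιk = <⇒≢ (ι-mono j<k)
      ...   | true =
        _ , edge-aa O (ι-mono j<k) Oιjk (k→only-ιj (ι k) (<⇒≢ (ι-mono j<k) ∘ sym)) , common

      unambiguous : ∀ {j k j′ k′ e e′} → j Fin.< k → j′ Fin.< k′ →
                    Witness j k e → Witness j′ k′ e′ → e ≡ e′ → (j , k) ≡ (j′ , k′)
      unambiguous _ _ shared shared e≡e′ =
        cong₂ _,_ (ι-injective (a-injective (,-injectiveˡ e≡e′))) (b-injective (,-injectiveʳ e≡e′))
      unambiguous _ _ common common e≡e′ =
        cong₂ _,_ (ι-injective (a-injective (,-injectiveˡ e≡e′)))
                  (ι-injective (a-injective (,-injectiveʳ e≡e′)))
      unambiguous _ _ (sole k→ιj) (sole k→ιj′) e≡e′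
        with refl ← b-injective (,-injectiveʳ e≡e′) =
        cong (_, _) (ι-injective (SoleOutB-unique O k→ιj k→ιj′))
      unambiguous j<k _ shared (sole _) e≡e′
        with refl ← b-injective (,-injectiveʳ e≡e′) =
        contradiction (ι-injective (a-injective (,-injectiveˡ e≡e′))) (<⇒≢ j<k)
      unambiguous _ j′<k′ (sole _) shared e≡e′
        with refl ← b-injective (,-injectiveʳ e≡e′) =
        contradiction (ι-injective (a-injective (sym (,-injectiveˡ e≡e′)))) (<⇒≢ j′<k′)
      unambiguous _ _ shared common e≡e′ = contradiction (sym (,-injectiveʳ e≡e′)) a≢b
      unambiguous _ _ (sole _) common e≡e′ = contradiction (sym (,-injectiveʳ e≡e′)) a≢b
      unambiguous _ _ common shared e≡e′ = contradiction (,-injectiveʳ e≡e′) a≢b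
      unambiguous _ _ common (sole _) e≡e′ = contradiction (,-injectiveʳ e≡e′) a≢b

      C₂≤edges₁₂-two-outs : n C 2 ≤ edges₁₂ D
      C₂≤edges₁₂-two-outs = C₂≤edges₁₂ D Witness witness unambiguous

    C₂≤edges₁₂-orientation : 3 ≤ m → n ≤ m → n C 2 ≤ edges₁₂ D
    C₂≤edges₁₂-orientation 3≤m n≤m with all? (twoOutsA? O)
    ... | yes two = TwoOuts.C₂≤edges₁₂-two-outs n≤m two
    ... | no ¬two
      with i₀ , ¬two-i₀ ← ¬∀⟶∃¬ m (TwoOutsA O) (twoOutsA? O) ¬two
      with sink-or-sole O ¬two-i₀
    ... | inj₁ sink = C₂≤edges₁₂-sink sink
    ... | inj₂ (_ , sole)
      with _ , _ , i₁≢i₀ , i₂≢i₀ , i₁<i₂ ← two-others 3≤m i₀ =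
      SoleOut.C₂≤edges₁₂-sole-out sole i₁≢i₀ i₂≢i₀ i₁<i₂

C₂≤edges₁₂-unless-2,2 : 0 < n → n ≤ m → ¬ (m ≡ 2 × n ≡ 2) →
                        (O : Orientation m n) → n C 2 ≤ edges₁₂ (toDigraph O)
C₂≤edges₁₂-unless-2,2 {n = suc zero} _ _ _ _ = z≤n
C₂≤edges₁₂-unless-2,2 {n = suc (suc _)} {m = suc (suc (suc _))} _ n≤m _ O =
  C₂≤edges₁₂-orientation O (s≤s (s≤s (s≤s z≤n))) n≤m
C₂≤edges₁₂-unless-2,2 {n = suc (suc zero)} {m = suc (suc zero)} _ _ not-2,2 _ =
  contradiction (refl , refl) not-2,2
C₂≤edges₁₂-unless-2,2 {n = suc (suc (suc _))} {m = suc (suc zero)} _ (s≤s (s≤s ())) _ _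
C₂≤edges₁₂-unless-2,2 {n = suc (suc _)} {m = suc zero} _ (s≤s ()) _ _
C₂≤edges₁₂-unless-2,2 {n = suc (suc _)} {m = zero} _ () _ _

-- The directed 4-cycle a₀ → b₀ → a₁ → b₁ → a₀.
cycle₄ : Orientation 2 2
cycle₄ i j = does (i ≟ j)

edges₁₂-cycle₄ : edges₁₂ (toDigraph cycle₄) ≡ 0
edges₁₂-cycle₄ = refl

theorem4p2 : (m n : ℕ) → 0 < n → n ≤ m → (O : Orientation m n)
    → ((O′ : Orientation m n) → edges₁₂ (toDigraph O) ≤ edges₁₂ (toDigraph O′))
    → ((m ≡ 2 × n ≡ 2) → edges₁₂ (toDigraph O) ≡ 0)
      × (¬ (m ≡ 2 × n ≡ 2) → edges₁₂ (toDigraph O) ≡ n C 2)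
theorem4p2 m n 0<n n≤m O minimal = K₂,₂ , not-K₂,₂
  where
  K₂,₂ : m ≡ 2 × n ≡ 2 → edges₁₂ (toDigraph O) ≡ 0
  K₂,₂ (refl , refl) = ℕ.n≤0⇒n≡0 (subst (edges₁₂ (toDigraph O) ≤_) edges₁₂-cycle₄ (minimal cycle₄))

  not-K₂,₂ : ¬ (m ≡ 2 × n ≡ 2) → edges₁₂ (toDigraph O) ≡ n C 2
  not-K₂,₂ not-2,2 = ℕ.≤-antisym (ℕ.≤-trans (minimal into-A) (edges₁₂-into-A {m}))
                                 (C₂≤edges₁₂-unless-2,2 0<n n≤m not-2,2 O)
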